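{- Let $A\subseteq\mathfrak S_n$ be Schur-positive and $\operatorname{cDes}$-invariant, and let $(m_\lambda)_{\lambda\vdash n}$ be nonnegative integers such that $\sum_{\pi\in A}\mathbf x^{\operatorname{Des}(\pi)}=\sum_{\lambda\vdash n}m_\lambda\sum_{T\in\operatorname{SYT}(\lambda)}\mathbf x^{\operatorname{Des}(T)}$. Then for every $0\le k<n$, $m_{(n-k,1^k)}=|\{a\in A:\operatorname{Des}(a)=[k]\}|$, where $[0]:=\emptyset$.
   Context: $[k]=\{1,\dots,k\}$. For $\pi\in\mathfrak{S}_n$: $\operatorname{Des}(\pi)=\{i\in[n-1]:\pi(i)>\pi(i+1)\}$ and $\operatorname{cDes}(\pi)=\{i\in[n]:\pi(i)>\pi(i+1)\}$ with $\pi(n+1):=\pi(1)$. For $J\subseteq[n]$, $\mathbf{x}^J=\prod_{i\in J}x_i$. For a (skew) shape $\lambda$ with $n$ cells, $\operatorname{SYT}(\lambda)$ is its set of standard Young tableaux (English notation) and $\operatorname{Des}(T)=\{i\in[n-1]: i+1$ is in a lower row than $i$ in $T\}$. $A$ is Schur-positive if $\sum_{\pi\in A}\mathcal F_{n,\operatorname{Des}(\pi)}$ is symmetric and Schur-positive, where $\mathcal F_{n,D}=\sum x_{i_1}\cdots x_{i_n}$ over $i_1\le\cdots\le i_n$ with $i_j<i_{j+1}$ for $j\in D$ (Gessel's fundamental quasisymmetric function); equivalently, nonnegative integers $m_\lambda$ as in the statement exist. $A$ is $\operatorname{cDes}$-invariant if there is a bijection $\psi:A\to A$ with $\operatorname{cDes}(\psi\pi)=1+\operatorname{cDes}(\pi)$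 (addition mod $n$, elementwise) for all $\pi\in A$. -}

module Defs where

open import Data.Nat using (ℕ; zero; suc; _+_; _*_; _<ᵇ_; _≤ᵇ_; _≡ᵇ_; _<?_)
open import Data.Bool using (Bool; true; false; _∧_; _∨_; not; if_then_else_)
import Data.Bool as Bool
open import Data.List using (List; []; _∷_; [_]; map; concatMap; length; upTo; filter; filterᵇ; take; drop; concat; replicate; allFin)
open import Data.Nat.ListAction using (sum)
open import Data.Bool.ListAction using (all; any)
open import Data.Fin using (Fin; zero; suc; toℕ; fromℕ<)
import Data.Fin as Fin
open import Data.Fin.Subset using (Subset)
open import Data.Fin.Permutation using (Permutation′; _⟨$⟩ʳ_)
open import Data.Vec using (Vec; tabulate; lookup)
open import Data.Vec.Properties using (≡-dec)
open import Relation.Nullary using (Dec; yes; no; does)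
open import Relation.Binary.PropositionalEquality using (_≡_)

-- Conventions.  A subset J ⊆ [n] = {1,…,n} is a 'Subset n' (= Vec Bool n);
-- position i : Fin n stands for the element i+1 ∈ [n].

_≟ₛ_ : ∀ {n} (J K : Subset n) → Dec (J ≡ K)
_≟ₛ_ = ≡-dec Bool._≟_

interval : ∀ {n} → ℕ → Subset n
interval k = tabulate (λ i → toℕ i <ᵇ k)

next : ∀ {n} → Fin n → Fin n
next {suc m} i with suc (toℕ i) <? suc m
... | yes p = fromℕ< p
... | no _  = zero

-- 1 + J = { j+1 mod n : j ∈ J }  (elementwise, with n+1 read as 1)
shift : ∀ {n} → Subset n → Subset n
shift {n} J = tabulate (λ j → any (λ i → lookup J i ∧ does (next i Fin.≟ j)) (allFin n))

-- Permutations π ∈ 𝔖_n (stdlib 'Permutation′ n', i.e. Fin n ↔ Fin n),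
-- written on positions 0..n-1; π(i) is 'π ⟨$⟩ʳ i'.

Des : ∀ {n} → Permutation′ n → Subset n
Des {n} π = tabulate (λ i → (suc (toℕ i) <ᵇ n) ∧ (toℕ (π ⟨$⟩ʳ next i) <ᵇ toℕ (π ⟨$⟩ʳ i)))

-- cDes(π) = { i ∈ [n] : π(i) > π(i+1) },  π(n+1) := π(1)
cDes : ∀ {n} → Permutation′ n → Subset n
cDes {n} π = tabulate (λ i → toℕ (π ⟨$⟩ʳ next i) <ᵇ toℕ (π ⟨$⟩ʳ i))

-- A finite set A ⊆ 𝔖_n is given as an injective (up to extensional
-- equality of permutations) family A : Fin N → Permutation′ n.
-- |{ a ∈ A : Des(a) = J }|
countDes : ∀ {N n} → (Fin N → Permutation′ n) → Subset n → ℕ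
countDes {N} A J = length (filter (λ i → Des (A i) ≟ₛ J) (allFin N))

words : ∀ {a} {X : Set a} → ℕ → List X → List (List X)
words zero    xs = [ [] ]
words (suc k) xs = concatMap (λ x → map (x ∷_) (words k xs)) xs

weaklyDecᵇ : List ℕ → Bool
weaklyDecᵇ (x ∷ y ∷ ys) = (y ≤ᵇ x) ∧ weaklyDecᵇ (y ∷ ys)
weaklyDecᵇ _ = true

IsPartitionᵇ : ℕ → List ℕ → Bool
IsPartitionᵇ n λ' = (sum λ' ≡ᵇ n) ∧ all (λ x → 0 <ᵇ x) λ' ∧ weaklyDecᵇ λ'

oneTo : ℕ → List ℕ
oneTo n = map suc (upTo n)

-- the list of all partitions of n, each exactly once
-- (a partition of n has at most n parts, each in [1..n])
partitions : ℕ → List (List ℕ)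
partitions n = filterᵇ (IsPartitionᵇ n) (concatMap (λ ℓ → words ℓ (oneTo n)) (upTo (suc n)))

hook : ℕ → ℕ → List ℕ
hook n k = (n Data.Nat.∸ k) ∷ replicate k 1

-- A tableau (English notation) is its list of rows (top row first).
-- cut a word into rows of lengths λ
splitRows : List ℕ → List ℕ → List (List ℕ)
splitRows []        w = []
splitRows (r ∷ rs) w = take r w ∷ splitRows rs (drop r w)

countᵇ : ℕ → List ℕ → ℕ
countᵇ v w = length (filterᵇ (λ x → x ≡ᵇ v) w)

strictIncᵇ : List ℕ → Bool
strictIncᵇ (x ∷ y ∷ ys) = (x <ᵇ y) ∧ strictIncᵇ (y ∷ ys)
strictIncᵇ _ = true

aboveᵇ : List ℕ → List ℕ → Bool
aboveᵇ (x ∷ xs) (y ∷ ys) = (x <ᵇ y) ∧ aboveᵇ xs ys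
aboveᵇ []       (y ∷ ys) = false
aboveᵇ _        []       = true

colsᵇ : List (List ℕ) → Bool
colsᵇ (R ∷ R' ∷ Rs) = aboveᵇ R R' ∧ colsᵇ (R' ∷ Rs)
colsᵇ _ = true

IsStandardᵇ : ℕ → List (List ℕ) → Bool
IsStandardᵇ n T = (length (concat T) ≡ᵇ n)
                ∧ all (λ v → countᵇ v (concat T) ≡ᵇ 1) (oneTo n)
                ∧ all strictIncᵇ T
                ∧ colsᵇ T

-- SYT(λ) for λ ⊢ n: all fillings of the shape λ by words over [1..n]
-- (read row by row), filtered by standardness; each tableau occurs once.
SYT : ℕ → List ℕ → List (List (List ℕ))
SYT n λ' = filterᵇ (IsStandardᵇ n) (map (splitRows λ') (words n (oneTo n)))

rowOf : ℕ → List (List ℕ) → ℕ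
rowOf v []       = 0
rowOf v (R ∷ Rs) = if any (λ x → x ≡ᵇ v) R then 0 else suc (rowOf v Rs)

DesT : (n : ℕ) → List (List ℕ) → Subset n
DesT n T = tabulate (λ i → (suc (toℕ i) <ᵇ n)
                         ∧ (rowOf (suc (toℕ i)) T <ᵇ rowOf (suc (suc (toℕ i))) T))

countSYT : (n : ℕ) → List ℕ → Subset n → ℕ
countSYT n λ' J = length (filter (λ T → DesT n T ≟ₛ J) (SYT n λ'))

module Submission where

-- Evaluating the expansion at J = [k] gives
--   |{ a ∈ A : Des(a) = [k] }| = Σ_{μ ⊢ n} m_μ · |{ T ∈ SYT(μ) : Des(T) = [k] }|,
-- so everything rests on one combinatorial fact: the hook tableau H(n,k), with top row
-- 1, k+2, …, n and first column 1, 2, …, k+1, is the only standard Young tableau of any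
-- shape whose descent set is [k]; the hook shape also occurs exactly once among the
-- partitions of n.
--
-- Uniqueness is proved through the row function d(v) = row index of v.  If Des(T) = [k]
-- then d(i+1) = i for i ≤ k (d rises along 1..k+1 and every entry exceeds its row index),
-- d never rises from k+1 on, and the column condition forces d(k+2) = 0; hence T has the
-- row function of H(n,k), and a standard tableau is determined by its row function.

open import Defs
open import Data.Nat using (ℕ; zero; suc; _+_; _*_; _∸_; _<_; _≤_; _<ᵇ_; _≡ᵇ_; z≤n; s≤s; s≤s⁻¹)
import Data.Nat as ℕ
open import Data.Nat.Properties
open import Data.Bool using (Bool; true; false; _∧_; T)
open import Data.Bool.Properties using (T-∧; T-≡)
open import Data.List using (List; []; _∷_; [_]; map; concatMap; length; upTo; filter; filterᵇ; take; drop; concat; replicate; _++_)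
open import Data.List.Properties using (∷-injective; length-take; length-drop; take++drop≡id; length-++; length-replicate)
import Data.List.Properties as List
open import Data.Nat.ListAction using (sum)
open import Data.Bool.ListAction using (all; any)
open import Data.List.Membership.Propositional using (_∈_; _∉_; find)
open import Data.List.Membership.Propositional.Properties using (∈-concatMap⁻; ∈-map⁺; ∈-map⁻; ∈-upTo⁺; ∈-upTo⁻; ∈-++⁺ˡ; ∈-++⁺ʳ; ∈-++⁻; ∈-filter⁻)
open import Data.List.Relation.Unary.Any using (here; there)
import Data.List.Relation.Unary.Any as Any
open import Data.List.Relation.Unary.Any.Properties using (any⁺; any⁻)
open import Data.List.Relation.Unary.All using (All; []; _∷_)
import Data.List.Relation.Unary.All as All
open import Data.List.Relation.Unary.All.Properties using (all⁺; all⁻)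
import Data.List.Relation.Unary.All.Properties as All
open import Data.List.Relation.Unary.AllPairs using ([]; _∷_)
open import Data.List.Relation.Unary.Unique.Propositional using (Unique)
import Data.List.Relation.Unary.Unique.Propositional.Properties as Unique
open import Data.Fin using (Fin; toℕ; fromℕ<)
open import Data.Fin.Properties using (toℕ-fromℕ<)
open import Data.Fin.Permutation using (Permutation′; _⟨$⟩ʳ_)
open import Data.Vec using (tabulate; lookup)
open import Data.Vec.Properties using (tabulate-cong; lookup∘tabulate)
open import Data.Product using (∃; _×_; _,_; proj₁; proj₂)
open import Data.Sum using (inj₁; inj₂)
open import Data.Empty using (⊥; ⊥-elim)
open import Function using (_∘_)
open import Function.Bundles using (Equivalence)
open import Relation.Nullary using (Dec; yes; no; ¬_; T?)
open import Relation.Unary using (Decidable)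
open import Relation.Binary using (DecidableEquality)
open import Relation.Binary.PropositionalEquality hiding ([_])

∧⁻ : ∀ {a b} → T (a ∧ b) → T a × T b
∧⁻ = Equivalence.to T-∧

∧⁺ : ∀ {a b} → T a → T b → T (a ∧ b)
∧⁺ p q = Equivalence.from T-∧ (p , q)

module Multiplicity {A : Set} (_≟_ : DecidableEquality A) where

  mult : A → List A → ℕ
  mult x [] = 0
  mult x (y ∷ ys) with x ≟ y
  ... | yes _ = suc (mult x ys)
  ... | no _  = mult x ys

  mult-here : ∀ {x y} ys → x ≡ y → mult x (y ∷ ys) ≡ suc (mult x ys)
  mult-here {x} {y} ys x≡y with x ≟ y
  ... | yes _   = refl
  ... | no x≢y  = ⊥-elim (x≢y x≡y)

  mult-there : ∀ {x y} ys → x ≢ y → mult x (y ∷ ys) ≡ mult x ys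
  mult-there {x} {y} ys x≢y with x ≟ y
  ... | yes x≡y = ⊥-elim (x≢y x≡y)
  ... | no _    = refl

  mult-++ : ∀ x xs ys → mult x (xs ++ ys) ≡ mult x xs + mult x ys
  mult-++ x []       ys = refl
  mult-++ x (y ∷ xs) ys with x ≟ y
  ... | yes _ = cong suc (mult-++ x xs ys)
  ... | no _  = mult-++ x xs ys

  mult-concatMap : ∀ {B : Set} x (f : B → List A) bs → mult x (concatMap f bs) ≡ sum (map (mult x ∘ f) bs)
  mult-concatMap x f []       = refl
  mult-concatMap x f (b ∷ bs) = trans (mult-++ x (f b) (concatMap f bs)) (cong (mult x (f b) +_) (mult-concatMap x f bs))

  mult-∉ : ∀ {x xs} → x ∉ xs → mult x xs ≡ 0
  mult-∉ {x} {[]}     _  = refl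
  mult-∉ {x} {y ∷ ys} x∉ with x ≟ y
  ... | yes x≡y = ⊥-elim (x∉ (here x≡y))
  ... | no _    = mult-∉ (x∉ ∘ there)

  mult-∈ : ∀ {x xs} → x ∈ xs → 0 < mult x xs
  mult-∈ {x} {y ∷ ys} x∈ with x ≟ y | x∈
  ... | yes _   | _         = s≤s z≤n
  ... | no x≢y  | here x≡y  = ⊥-elim (x≢y x≡y)
  ... | no _    | there x∈′ = mult-∈ x∈′

  mult-pos : ∀ {x} xs → 0 < mult x xs → x ∈ xs
  mult-pos {x} (y ∷ ys) pos with x ≟ y
  ... | yes x≡y = here x≡y
  ... | no _    = there (mult-pos ys pos)

  mult-unique : ∀ {x xs} → Unique xs → x ∈ xs → mult x xs ≡ 1
  mult-unique {x} {y ∷ ys} (y∉ys ∷ u) x∈ with x ≟ y | x∈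
  ... | yes refl | _         = cong suc (mult-∉ (λ x∈ys → All.lookup y∉ys x∈ys refl))
  ... | no x≢y   | here x≡y  = ⊥-elim (x≢y x≡y)
  ... | no _     | there x∈′ = mult-unique u x∈′

  mult-filterᵇ : ∀ {x} (b : A → Bool) xs → T (b x) → mult x (filterᵇ b xs) ≡ mult x xs
  mult-filterᵇ b []       bx = refl
  mult-filterᵇ {x} b (y ∷ ys) bx with b y in eq
  ... | true with x ≟ y
  ...   | yes _    = cong suc (mult-filterᵇ b ys bx)
  ...   | no _     = mult-filterᵇ b ys bx
  mult-filterᵇ {x} b (y ∷ ys) bx | false with x ≟ y
  ...   | yes refl = ⊥-elim (subst T eq bx)
  ...   | no _     = mult-filterᵇ b ys bx

  sum-concentrated : ∀ (g : A → ℕ) x xs → (∀ y → y ∈ xs → y ≢ x → g y ≡ 0) → sum (map g xs) ≡ g x * mult x xs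
  sum-concentrated g x []       _     = sym (*-zeroʳ (g x))
  sum-concentrated g x (y ∷ ys) vanish with x ≟ y
  ... | yes refl = trans (cong (g x +_) (sum-concentrated g x ys (λ z → vanish z ∘ there))) (sym (*-suc (g x) _))
  ... | no x≢y   = cong₂ _+_ (vanish y (here refl) (x≢y ∘ sym)) (sum-concentrated g x ys (λ z → vanish z ∘ there))

  module _ {B : Set} (f : A → B) (b : B → Bool) {P : B → Set} (P? : Decidable P) where

    count-images-unique : ∀ ws w₀ → (∀ w → w ∈ ws → T (b (f w)) → P (f w) → w ≡ w₀)
                        → T (b (f w₀)) → P (f w₀) → length (filter P? (filterᵇ b (map f ws))) ≡ mult w₀ ws
    count-images-unique []       w₀ _    _  _  = refl
    count-images-unique (w ∷ ws) w₀ only b₀ p₀ with w₀ ≟ w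
    ... | yes refl with b (f w) in eq
    ...   | false = ⊥-elim b₀
    ...   | true with P? (f w)
    ...     | yes _ = cong suc (count-images-unique ws w₀ (λ v → only v ∘ there) (subst T (sym eq) _) p₀)
    ...     | no ¬p = ⊥-elim (¬p p₀)
    count-images-unique (w ∷ ws) w₀ only b₀ p₀ | no w₀≢w with b (f w) in eq
    ...   | false = count-images-unique ws w₀ (λ v → only v ∘ there) b₀ p₀
    ...   | true with P? (f w)
    ...     | yes p = ⊥-elim (w₀≢w (sym (only w (here refl) (subst T (sym eq) _) p)))
    ...     | no _  = count-images-unique ws w₀ (λ v → only v ∘ there) b₀ p₀

    count-images-none : ∀ ws → (∀ w → w ∈ ws → T (b (f w)) → ¬ P (f w)) → length (filter P? (filterᵇ b (map f ws))) ≡ 0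
    count-images-none ws none = cong length (List.filter-none P? (All.tabulate rejected))
      where
      rejected : ∀ {y} → y ∈ filterᵇ b (map f ws) → ¬ P y
      rejected y∈ with ∈-filter⁻ (T? ∘ b) y∈
      ... | y∈′ , by with ∈-map⁻ f y∈′
      ...   | w , w∈ , refl = none w w∈ by

module Mℕ = Multiplicity ℕ._≟_
module Mw = Multiplicity (List.≡-dec ℕ._≟_)

countᵇ≡mult : ∀ v xs → countᵇ v xs ≡ Mℕ.mult v xs
countᵇ≡mult v []       = refl
countᵇ≡mult v (x ∷ xs) with x ≡ᵇ v in eq
... | true  = trans (cong suc (countᵇ≡mult v xs)) (sym (Mℕ.mult-here xs (sym (≡ᵇ⇒≡ x v (subst T (sym eq) _)))))
... | false = trans (countᵇ≡mult v xs) (sym (Mℕ.mult-there xs (λ v≡x → subst T eq (≡⇒≡ᵇ x v (sym v≡x)))))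

words-∈⁻ : ∀ ℓ (xs : List ℕ) {w} → w ∈ words ℓ xs → length w ≡ ℓ × All (_∈ xs) w
words-∈⁻ zero    xs (here refl) = refl , []
words-∈⁻ (suc ℓ) xs w∈ with find (∈-concatMap⁻ (λ x → map (x ∷_) (words ℓ xs)) {xs = xs} w∈)
... | x , x∈ , w∈′ with ∈-map⁻ (x ∷_) w∈′
...   | w′ , w′∈ , refl with words-∈⁻ ℓ xs w′∈
...     | len , letters = cong suc len , x∈ ∷ letters

mult-prefix : ∀ a w L → Mw.mult (a ∷ w) (map (a ∷_) L) ≡ Mw.mult w L
mult-prefix a w []      = refl
mult-prefix a w (v ∷ L) = by-cases (List.≡-dec ℕ._≟_ w v)
  where
  by-cases : Dec (w ≡ v) → Mw.mult (a ∷ w) (map (a ∷_) (v ∷ L)) ≡ Mw.mult w (v ∷ L)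
  by-cases (yes refl) = trans (Mw.mult-here (map (a ∷_) L) refl)
                              (trans (cong suc (mult-prefix a w L)) (sym (Mw.mult-here L refl)))
  by-cases (no w≢v)   = trans (Mw.mult-there (map (a ∷_) L) (w≢v ∘ proj₂ ∘ ∷-injective))
                              (trans (mult-prefix a w L) (sym (Mw.mult-there L w≢v)))

mult-other-prefix : ∀ {a b} w L → a ≢ b → Mw.mult (a ∷ w) (map (b ∷_) L) ≡ 0
mult-other-prefix {a} {b} w L a≢b = Mw.mult-∉ {a ∷ w} {map (b ∷_) L} λ aw∈ →
  let _ , _ , eq = ∈-map⁻ (b ∷_) aw∈ in a≢b (proj₁ (∷-injective eq))

mult-words : ∀ ℓ xs w → length w ≡ ℓ → All (λ a → Mℕ.mult a xs ≡ 1) w → Mw.mult w (words ℓ xs) ≡ 1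
mult-words zero    xs []      refl []                = refl
mult-words (suc ℓ) xs (a ∷ w) refl (a-once ∷ w-once) = begin
  Mw.mult (a ∷ w) (words (suc ℓ) xs)
    ≡⟨ Mw.mult-concatMap (a ∷ w) (λ x → map (x ∷_) (words ℓ xs)) xs ⟩
  sum (map (λ x → Mw.mult (a ∷ w) (map (x ∷_) (words ℓ xs))) xs)
    ≡⟨ Mℕ.sum-concentrated _ a xs (λ x _ x≢a → mult-other-prefix w (words ℓ xs) (x≢a ∘ sym)) ⟩
  Mw.mult (a ∷ w) (map (a ∷_) (words ℓ xs)) * Mℕ.mult a xs
    ≡⟨ cong₂ _*_ (trans (mult-prefix a w (words ℓ xs)) (mult-words ℓ xs w refl w-once)) a-once ⟩
  1 ∎
  where open ≡-Reasoning

mult-words-length : ∀ ℓ xs w → length w ≢ ℓ → Mw.mult w (words ℓ xs) ≡ 0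
mult-words-length ℓ xs w len≢ = Mw.mult-∉ (len≢ ∘ proj₁ ∘ words-∈⁻ ℓ xs)

∈-oneTo⁺ : ∀ {n a} → 1 ≤ a → a ≤ n → a ∈ oneTo n
∈-oneTo⁺ {n} {suc a} _ a≤n = ∈-map⁺ suc (∈-upTo⁺ a≤n)

∈-oneTo⁻ : ∀ {n a} → a ∈ oneTo n → 1 ≤ a × a ≤ n
∈-oneTo⁻ a∈ with ∈-map⁻ suc a∈
... | b , b∈ , refl = s≤s z≤n , ∈-upTo⁻ b∈

mult-oneTo : ∀ {n a} → 1 ≤ a → a ≤ n → Mℕ.mult a (oneTo n) ≡ 1
mult-oneTo {n} 1≤a a≤n = Mℕ.mult-unique (Unique.map⁺ suc-injective (Unique.upTo⁺ n)) (∈-oneTo⁺ 1≤a a≤n)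

rest-fits : ∀ r μ (w : List ℕ) → length w ≡ r + sum μ → length (drop r w) ≡ sum μ
rest-fits r μ w len = trans (length-drop r w) (trans (cong (_∸ r) len) (m+n∸m≡n r (sum μ)))

splitRows-concat : ∀ μ (w : List ℕ) → length w ≡ sum μ → concat (splitRows μ w) ≡ w
splitRows-concat []      [] _   = refl
splitRows-concat (r ∷ μ) w  len =
  trans (cong (take r w ++_) (splitRows-concat μ (drop r w) (rest-fits r μ w len))) (take++drop≡id r w)

splitRows-lengths : ∀ μ (w : List ℕ) → length w ≡ sum μ → map length (splitRows μ w) ≡ μ
splitRows-lengths []      w _   = refl
splitRows-lengths (r ∷ μ) w len = cong₂ _∷_
  (trans (length-take r w) (trans (cong (r ℕ.⊓_) len) (m≤n⇒m⊓n≡m (m≤m+n r (sum μ)))))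
  (splitRows-lengths μ (drop r w) (rest-fits r μ w len))

splitRows-concat-inverse : ∀ τ → splitRows (map length τ) (concat τ) ≡ τ
splitRows-concat-inverse []      = refl
splitRows-concat-inverse (R ∷ τ) =
  cong₂ _∷_ (take-length-++ R (concat τ)) (trans (cong (splitRows (map length τ)) (drop-length-++ R (concat τ))) (splitRows-concat-inverse τ))
  where
  take-length-++ : ∀ (xs ys : List ℕ) → take (length xs) (xs ++ ys) ≡ xs
  take-length-++ []       ys = refl
  take-length-++ (x ∷ xs) ys = cong (x ∷_) (take-length-++ xs ys)
  drop-length-++ : ∀ (xs ys : List ℕ) → drop (length xs) (xs ++ ys) ≡ ys
  drop-length-++ []       ys = refl
  drop-length-++ (x ∷ xs) ys = drop-length-++ xs ys

Row : List (List ℕ) → ℕ → List ℕ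
Row []       j       = []
Row (R ∷ τ) zero    = R
Row (R ∷ τ) (suc j) = Row τ j

Row-∈-concat : ∀ τ j {x} → x ∈ Row τ j → x ∈ concat τ
Row-∈-concat (R ∷ τ) zero    x∈ = ∈-++⁺ˡ x∈
Row-∈-concat (R ∷ τ) (suc j) x∈ = ∈-++⁺ʳ R (Row-∈-concat τ j x∈)

Row-all : ∀ {P : List ℕ → Set} τ → All P τ → P [] → ∀ j → P (Row τ j)
Row-all []      _          P[] j       = P[]
Row-all (R ∷ τ) (PR ∷ _)  P[] zero    = PR
Row-all (R ∷ τ) (_ ∷ Pτ)  P[] (suc j) = Row-all τ Pτ P[] j

data Cell : List ℕ → ℕ → ℕ → Set where
  first : ∀ {x xs} → Cell (x ∷ xs) 0 x
  later : ∀ {x xs c y} → Cell xs c y → Cell (x ∷ xs) (suc c) y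

Cell-∈ : ∀ {R c x} → Cell R c x → x ∈ R
Cell-∈ first     = here refl
Cell-∈ (later c) = there (Cell-∈ c)

∈-Cell : ∀ {R x} → x ∈ R → ∃ λ c → Cell R c x
∈-Cell (here refl) = 0 , first
∈-Cell (there x∈) = let c , cell = ∈-Cell x∈ in suc c , later cell

strictInc-tail : ∀ h xs → T (strictIncᵇ (h ∷ xs)) → T (strictIncᵇ xs)
strictInc-tail h []       _   = _
strictInc-tail h (y ∷ ys) inc = proj₂ (∧⁻ {h <ᵇ y} inc)

head-below : ∀ h xs {x} → T (strictIncᵇ (h ∷ xs)) → x ∈ xs → h < x
head-below h (y ∷ ys) inc (here refl) = <ᵇ⇒< h y (proj₁ (∧⁻ {h <ᵇ y} inc))
head-below h (y ∷ ys) inc (there x∈) =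
  <-trans (<ᵇ⇒< h y (proj₁ (∧⁻ {h <ᵇ y} inc))) (head-below y ys (proj₂ (∧⁻ {h <ᵇ y} inc)) x∈)

above-cell : ∀ R R′ {c x} → T (aboveᵇ R R′) → Cell R′ c x → ∃ λ u → Cell R c u × u < x
above-cell (y ∷ ys) (x ∷ xs) ok first     = y , first , <ᵇ⇒< y x (proj₁ (∧⁻ {y <ᵇ x} ok))
above-cell (y ∷ ys) (x ∷ xs) ok (later c) =
  let u , cell , u<x = above-cell ys xs (proj₂ (∧⁻ {y <ᵇ x} ok)) c in u , later cell , u<x

column-step : ∀ τ j {c x} → T (colsᵇ τ) → Cell (Row τ (suc j)) c x → ∃ λ u → Cell (Row τ j) c u × u < x
column-step (R ∷ R′ ∷ τ) zero    cols cell = above-cell R R′ (proj₁ (∧⁻ {aboveᵇ R R′} cols)) cell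
column-step (R ∷ R′ ∷ τ) (suc j) cols cell = column-step (R′ ∷ τ) j (proj₂ (∧⁻ {aboveᵇ R R′} cols)) cell

entry-exceeds-row : ∀ τ → (∀ {x} → x ∈ concat τ → 1 ≤ x) → T (colsᵇ τ) → ∀ j {x} → x ∈ Row τ j → j < x
entry-exceeds-row τ pos cols j x∈ = in-column j (proj₂ (∈-Cell x∈))
  where
  in-column : ∀ j {c x} → Cell (Row τ j) c x → j < x
  in-column zero    cell = pos (Row-∈-concat τ 0 (Cell-∈ cell))
  in-column (suc j) cell = let _ , cell′ , u<x = column-step τ j cols cell in ≤-<-trans (in-column j cell′) u<x

contains-true : ∀ {v R} → v ∈ R → T (any (λ y → y ≡ᵇ v) R)
contains-true {v} {R} v∈ = any⁺ (λ y → y ≡ᵇ v) (Any.map (λ { refl → ≡⇒≡ᵇ v v refl }) v∈)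

contains-∈ : ∀ {v} R → T (any (λ y → y ≡ᵇ v) R) → v ∈ R
contains-∈ {v} R ok = Any.map (λ {y} eq → sym (≡ᵇ⇒≡ y v eq)) (any⁻ (λ y → y ≡ᵇ v) R ok)

rowOf-∈ : ∀ τ {v} → v ∈ concat τ → v ∈ Row τ (rowOf v τ)
rowOf-∈ (R ∷ τ) {v} v∈ with any (λ y → y ≡ᵇ v) R in eq
... | true  = contains-∈ R (subst T (sym eq) _)
... | false with ∈-++⁻ R v∈
...   | inj₁ v∈R = ⊥-elim (subst T eq (contains-true v∈R))
...   | inj₂ v∈τ = rowOf-∈ τ v∈τ

rowOf-exact : ∀ τ j {v} → Mℕ.mult v (concat τ) ≤ 1 → v ∈ Row τ j → rowOf v τ ≡ j
rowOf-exact (R ∷ τ) zero    {v} _    v∈ with any (λ y → y ≡ᵇ v) R in eq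
... | true  = refl
... | false = ⊥-elim (subst T eq (contains-true v∈))
rowOf-exact (R ∷ τ) (suc j) {v} once v∈ with any (λ y → y ≡ᵇ v) R in eq
... | true  = ⊥-elim (<⇒≱ twice once)
  where
  twice : 1 < Mℕ.mult v (concat (R ∷ τ))
  twice = subst (1 <_) (sym (Mℕ.mult-++ v R (concat τ)))
            (+-mono-≤ (Mℕ.mult-∈ (contains-∈ R (subst T (sym eq) _))) (Mℕ.mult-∈ (Row-∈-concat τ j v∈)))
... | false = cong suc (rowOf-exact τ j (≤-trans (m≤n+m _ (Mℕ.mult v R)) (subst (_≤ 1) (Mℕ.mult-++ v R (concat τ)) once)) v∈)

record Standard (n : ℕ) (τ : List (List ℕ)) : Set where
  field
    entries-in-range   : ∀ {x} → x ∈ concat τ → 1 ≤ x × x ≤ n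
    occurs-once        : ∀ {v} → 1 ≤ v → v ≤ n → Mℕ.mult v (concat τ) ≡ 1
    rows-increasing    : ∀ j → T (strictIncᵇ (Row τ j))
    columns-increasing : T (colsᵇ τ)
    rows-nonempty      : All (λ R → 0 < length R) τ

  entry-exceeds : ∀ j {x} → x ∈ Row τ j → j < x
  entry-exceeds = entry-exceeds-row τ (proj₁ ∘ entries-in-range) columns-increasing

  member-of-row : ∀ {v} → 1 ≤ v → v ≤ n → v ∈ Row τ (rowOf v τ)
  member-of-row 1≤v v≤n = rowOf-∈ τ (Mℕ.mult-pos (concat τ) (subst (0 <_) (sym (occurs-once 1≤v v≤n)) (s≤s z≤n)))

  row-of-member : ∀ j {v} → v ∈ Row τ j → rowOf v τ ≡ j
  row-of-member j v∈ with entries-in-range (Row-∈-concat τ j v∈)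
  ... | 1≤v , v≤n = rowOf-exact τ j (≤-reflexive (occurs-once 1≤v v≤n)) v∈

  rowOf-below : ∀ {v} → 1 ≤ v → v ≤ n → rowOf v τ < v
  rowOf-below {v} 1≤v v≤n = entry-exceeds (rowOf v τ) (member-of-row 1≤v v≤n)

standard-view : ∀ n τ → (∀ {x} → x ∈ concat τ → 1 ≤ x × x ≤ n) → All (λ R → 0 < length R) τ
              → T (IsStandardᵇ n τ) → Standard n τ
standard-view n τ range nonempty std = record
  { entries-in-range   = range
  ; occurs-once        = λ 1≤v v≤n → trans (sym (countᵇ≡mult _ (concat τ)))
                                        (≡ᵇ⇒≡ _ 1 (All.lookup (all⁺ _ (oneTo n) counts) (∈-oneTo⁺ 1≤v v≤n)))
  ; rows-increasing    = Row-all τ (all⁺ strictIncᵇ τ rows) _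
  ; columns-increasing = cols
  ; rows-nonempty      = nonempty
  }
  where
  counts-rows-cols = proj₂ (∧⁻ {length (concat τ) ≡ᵇ n} std)
  counts = proj₁ (∧⁻ {all (λ v → countᵇ v (concat τ) ≡ᵇ 1) (oneTo n)} counts-rows-cols)
  rows-cols = proj₂ (∧⁻ {all (λ v → countᵇ v (concat τ) ≡ᵇ 1) (oneTo n)} counts-rows-cols)
  rows = proj₁ (∧⁻ {all strictIncᵇ τ} rows-cols)
  cols = proj₂ (∧⁻ {all strictIncᵇ τ} rows-cols)

-- A standard tableau is determined by its row function.

increasing-≡ : ∀ xs ys → T (strictIncᵇ xs) → T (strictIncᵇ ys)
             → (∀ {x} → x ∈ xs → x ∈ ys) → (∀ {x} → x ∈ ys → x ∈ xs) → xs ≡ ys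
increasing-≡ []       []       _  _  _  _  = refl
increasing-≡ []       (y ∷ ys) _  _  _  ⊇ with ⊇ (here refl)
... | ()
increasing-≡ (x ∷ xs) []       _  _  ⊆  _  with ⊆ (here refl)
... | ()
increasing-≡ (x ∷ xs) (y ∷ ys) ix iy ⊆ ⊇ =
  cong₂ _∷_ x≡y (increasing-≡ xs ys (strictInc-tail x xs ix) (strictInc-tail y ys iy) ⊆′ ⊇′)
  where
  x≡y : x ≡ y
  x≡y with ⊆ (here refl) | ⊇ (here refl)
  ... | here x≡y  | _         = x≡y
  ... | there _   | here y≡x  = sym y≡x
  ... | there x∈  | there y∈  = ⊥-elim (<-asym (head-below y ys iy x∈) (head-below x xs ix y∈))
  ⊆′ : ∀ {z} → z ∈ xs → z ∈ ys
  ⊆′ z∈ with ⊆ (there z∈)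
  ... | here refl = ⊥-elim (<-irrefl x≡y (head-below x xs ix z∈))
  ... | there z∈′ = z∈′
  ⊇′ : ∀ {z} → z ∈ ys → z ∈ xs
  ⊇′ z∈ with ⊇ (there z∈)
  ... | here refl = ⊥-elim (<-irrefl (sym x≡y) (head-below y ys iy z∈))
  ... | there z∈′ = z∈′

rows-≡ : ∀ τ σ → All (λ R → 0 < length R) τ → All (λ R → 0 < length R) σ → (∀ j → Row τ j ≡ Row σ j) → τ ≡ σ
rows-≡ []      []      _          _          _    = refl
rows-≡ []      (S ∷ σ) _          (S≠[] ∷ _) same = ⊥-elim (<⇒≢ S≠[] (cong length (same 0)))
rows-≡ (R ∷ τ) []      (R≠[] ∷ _) _          same = ⊥-elim (<⇒≢ R≠[] (sym (cong length (same 0))))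
rows-≡ (R ∷ τ) (S ∷ σ) (_ ∷ neτ)  (_ ∷ neσ)  same = cong₂ _∷_ (same 0) (rows-≡ τ σ neτ neσ (same ∘ suc))

row-transfer : ∀ {n τ σ} → Standard n τ → Standard n σ → (∀ {v} → 1 ≤ v → v ≤ n → rowOf v τ ≡ rowOf v σ)
             → ∀ j {x} → x ∈ Row τ j → x ∈ Row σ j
row-transfer {τ = τ} {σ} Sτ Sσ agree j {x} x∈ with Standard.entries-in-range Sτ (Row-∈-concat τ j x∈)
... | 1≤x , x≤n = subst (λ r → x ∈ Row σ r) (trans (sym (agree 1≤x x≤n)) (Standard.row-of-member Sτ j x∈))
                        (Standard.member-of-row Sσ 1≤x x≤n)

same-row-function : ∀ {n τ σ} → Standard n τ → Standard n σ
                  → (∀ {v} → 1 ≤ v → v ≤ n → rowOf v τ ≡ rowOf v σ) → τ ≡ σ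
same-row-function {τ = τ} {σ} Sτ Sσ agree =
  rows-≡ τ σ (Standard.rows-nonempty Sτ) (Standard.rows-nonempty Sσ) λ j →
    increasing-≡ (Row τ j) (Row σ j) (Standard.rows-increasing Sτ j) (Standard.rows-increasing Sσ j)
      (row-transfer Sτ Sσ agree j) (row-transfer Sσ Sτ (λ 1≤v v≤n → sym (agree 1≤v v≤n)) j)

-- Descent set [k] forces the row function of the hook tableau.

record HookRows (n k : ℕ) (τ : List (List ℕ)) : Set where
  field
    first-column : ∀ {i} → i ≤ k → rowOf (suc i) τ ≡ i
    first-row    : ∀ {v} → suc (suc k) ≤ v → v ≤ n → rowOf v τ ≡ 0

hook-rows-agree : ∀ {n k τ σ} → HookRows n k τ → HookRows n k σ → ∀ {v} → 1 ≤ v → v ≤ n → rowOf v τ ≡ rowOf v σ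
hook-rows-agree {k = k} Hτ Hσ {suc i} _ v≤n with i ≤? k
... | yes i≤k = trans (HookRows.first-column Hτ i≤k) (sym (HookRows.first-column Hσ i≤k))
... | no  i≰k = trans (HookRows.first-row Hτ (s≤s (≰⇒> i≰k)) v≤n) (sym (HookRows.first-row Hσ (s≤s (≰⇒> i≰k)) v≤n))

first-least : ∀ R {h x} → T (strictIncᵇ R) → Cell R 0 h → x ∈ R → h ≤ x
first-least (h ∷ xs) inc first (here refl) = ≤-refl
first-least (h ∷ xs) inc first (there x∈)  = <⇒≤ (head-below h xs inc x∈)

first-below-later : ∀ R {c x} → T (strictIncᵇ R) → Cell R (suc c) x → ∃ λ h → Cell R 0 h × h < x
first-below-later (h ∷ xs) inc (later cell) = h , first , head-below h xs inc (Cell-∈ cell)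

-- Hypotheses: τ is standard and its descents are exactly 1..k, i.e. for consecutive
-- entries the row index rises before k+1 and does not rise from k+1 on.
module DescentInterval {n k τ} (k<n : k < n) (S : Standard n τ)
  (ascent     : ∀ {i} → i < k → rowOf (suc i) τ < rowOf (suc (suc i)) τ)
  (non-ascent : ∀ {v} → k < v → suc v ≤ n → rowOf (suc v) τ ≤ rowOf v τ) where

  open Standard S

  d : ℕ → ℕ
  d v = rowOf v τ

  -- rows strictly descend along 1, …, k+1, and an entry exceeds its row index
  first-column : ∀ {i} → i ≤ k → d (suc i) ≡ i
  first-column {i} i≤k = ≤-antisym (s≤s⁻¹ (rowOf-below (s≤s z≤n) (≤-trans (s≤s i≤k) k<n))) (descends i≤k)
    where
    descends : ∀ {i} → i ≤ k → i ≤ d (suc i)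
    descends {zero}  _   = z≤n
    descends {suc i} i<k = <-≤-trans (s≤s (descends (<⇒≤ i<k))) (ascent i<k)

  first-column′ : ∀ {u} → 1 ≤ u → u ≤ suc k → suc (d u) ≡ u
  first-column′ {suc i} _ (s≤s i≤k) = cong suc (first-column i≤k)

  non-rising : ∀ {u} v → k < u → u ≤ v → v ≤ n → d v ≤ d u
  non-rising {u} v k<u u≤v v≤n with m≤n⇒m<n∨m≡n u≤v
  ... | inj₂ refl = ≤-refl
  non-rising {u} (suc v) k<u _ v<n | inj₁ (s≤s u≤v) =
    ≤-trans (non-ascent (<-≤-trans k<u u≤v) v<n) (non-rising v k<u u≤v (<⇒≤ v<n))

  -- k+2 lies in the top row: otherwise the column condition would squeeze it between 1..k+1
  k+2-on-top : suc (suc k) ≤ n → d (suc (suc k)) ≡ 0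
  k+2-on-top k+2≤n with d (suc (suc k)) in eq
  ... | zero  = refl
  ... | suc r = ⊥-elim (placed (∈-Cell v∈))
    where
    v = suc (suc k)
    r<k : suc r ≤ k
    r<k = subst (_≤ k) eq (subst (d v ≤_) (first-column ≤-refl) (non-rising v ≤-refl (n≤1+n _) k+2≤n))
    v∈ : v ∈ Row τ (suc r)
    v∈ = subst (λ j → v ∈ Row τ j) eq (member-of-row (s≤s z≤n) k+2≤n)
    placed : ∃ (λ c → Cell (Row τ (suc r)) c v) → ⊥
    -- in column 0, v would be the least entry of a row that also contains r+2 < v
    placed (zero , cell) = <⇒≱ (s≤s (s≤s r<k))
      (first-least (Row τ (suc r)) (rows-increasing (suc r)) cell
        (subst (λ j → suc (suc r) ∈ Row τ j) (first-column r<k) (member-of-row (s≤s z≤n) (≤-trans (s≤s r<k) k<n))))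
    -- in a later column, the entry u < v above it would be r+1, the least entry of row r
    placed (suc c , cell) with column-step τ r columns-increasing cell
    ... | u , u-cell , u<v with first-below-later (Row τ r) (rows-increasing r) u-cell
    ...   | h , h-cell , h<u = <-irrefl refl (<-≤-trans (entry-exceeds r (Cell-∈ h-cell)) (s≤s⁻¹ (subst (h <_) u≡r+1 h<u)))
      where
      1≤u : 1 ≤ u
      1≤u = proj₁ (entries-in-range (Row-∈-concat τ r (Cell-∈ u-cell)))
      u≡r+1 : u ≡ suc r
      u≡r+1 = trans (sym (first-column′ 1≤u (s≤s⁻¹ u<v))) (cong suc (row-of-member r (Cell-∈ u-cell)))

  -- every v ≥ k+2 lies weakly above k+2, hence in the top row
  hook-rows : HookRows n k τ
  hook-rows = record
    { first-column = first-column
    ; first-row    = λ {v} k+2≤v v≤n → n≤0⇒n≡0 (subst (d v ≤_) (k+2-on-top (≤-trans k+2≤v v≤n)) (non-rising v (m≤n+m (suc k) 1) k+2≤v v≤n))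
    }

<ᵇ-true : ∀ {m n} → m < n → (m <ᵇ n) ≡ true
<ᵇ-true m<n = Equivalence.to T-≡ (<⇒<ᵇ m<n)

<ᵇ-false : ∀ {m n} → n ≤ m → (m <ᵇ n) ≡ false
<ᵇ-false {m} {n} n≤m with m <ᵇ n in eq
... | true  = ⊥-elim (<⇒≱ (<ᵇ⇒< m n (subst T (sym eq) _)) n≤m)
... | false = refl

tabulate-≡-at : ∀ {A : Set} {n} {f g : Fin n → A} → tabulate f ≡ tabulate g → ∀ i → f i ≡ g i
tabulate-≡-at {f = f} {g} eq i = trans (sym (lookup∘tabulate f i)) (trans (cong (λ V → lookup V i) eq) (lookup∘tabulate g i))

descent-step : ∀ n k τ → DesT n τ ≡ interval k → ∀ i → suc i < n
             → (rowOf (suc i) τ <ᵇ rowOf (suc (suc i)) τ) ≡ (i <ᵇ k)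
descent-step n k τ des i i+1<n with tabulate-≡-at des (fromℕ< (<-trans (n<1+n i) i+1<n))
... | at rewrite toℕ-fromℕ< (<-trans (n<1+n i) i+1<n) | <ᵇ-true i+1<n = at

hook-descents : ∀ {n k τ} → k < n → HookRows n k τ → DesT n τ ≡ interval k
hook-descents {n} {k} {τ} k<n H = tabulate-cong (λ i → at (toℕ i))
  where
  open HookRows H
  -- position t < k: t+1, t+2 lie in rows t, t+1; position t ≥ k: t+2 lies in the top row,
  -- unless t+1 = n, which is never a descent position
  at : ∀ t → ((suc t <ᵇ n) ∧ (rowOf (suc t) τ <ᵇ rowOf (suc (suc t)) τ)) ≡ (t <ᵇ k)
  at t with t <? k
  ... | yes t<k rewrite <ᵇ-true (<-≤-trans (s≤s t<k) k<n) | first-column (<⇒≤ t<k) | first-column t<k | <ᵇ-true t<k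
      = <ᵇ-true (n<1+n t)
  ... | no t≮k with suc t <? n
  ...   | yes t+1<n rewrite <ᵇ-true t+1<n | first-row (s≤s (s≤s (≮⇒≥ t≮k))) t+1<n | <ᵇ-false (≮⇒≥ t≮k) = refl
  ...   | no t+1≮n rewrite <ᵇ-false (≮⇒≥ t+1≮n) | <ᵇ-false (≮⇒≥ t≮k) = refl

descents-force-hook-rows : ∀ {n k τ} → k < n → Standard n τ → DesT n τ ≡ interval k → HookRows n k τ
descents-force-hook-rows {n} {k} {τ} k<n S des = DescentInterval.hook-rows k<n S ascent non-ascent
  where
  ascent : ∀ {i} → i < k → rowOf (suc i) τ < rowOf (suc (suc i)) τ
  ascent {i} i<k = <ᵇ⇒< _ _ (Equivalence.from T-≡ (trans (descent-step n k τ des i (<-≤-trans (s≤s i<k) k<n)) (<ᵇ-true i<k)))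
  non-ascent : ∀ {v} → k < v → suc v ≤ n → rowOf (suc v) τ ≤ rowOf v τ
  non-ascent {suc i} (s≤s k≤i) v<n = ≮⇒≥ λ rises →
    subst T (trans (descent-step n k τ des i v<n) (<ᵇ-false k≤i)) (<⇒<ᵇ rises)

-- The hook tableau.

run : ℕ → ℕ → List ℕ
run a zero    = []
run a (suc l) = a ∷ run (suc a) l

∈-run⁻ : ∀ a l {x} → x ∈ run a l → a ≤ x × x < a + l
∈-run⁻ a (suc l) (here refl) = ≤-refl , subst (a <_) (sym (+-suc a l)) (s≤s (m≤m+n a l))
∈-run⁻ a (suc l) {x} (there x∈) with ∈-run⁻ (suc a) l x∈
... | a<x , x<a+l = <⇒≤ a<x , subst (x <_) (sym (+-suc a l)) x<a+l

∈-run⁺ : ∀ a l {x} → a ≤ x → x < a + l → x ∈ run a l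
∈-run⁺ a zero {x} a≤x x<a = ⊥-elim (<⇒≱ x<a (subst (_≤ x) (sym (+-identityʳ a)) a≤x))
∈-run⁺ a (suc l) {x} a≤x x<a+l with a ℕ.≟ x
... | yes refl = here refl
... | no a≢x   = there (∈-run⁺ (suc a) l (≤∧≢⇒< a≤x a≢x) (subst (x <_) (+-suc a l) x<a+l))

length-run : ∀ a l → length (run a l) ≡ l
length-run a zero    = refl
length-run a (suc l) = cong suc (length-run (suc a) l)

run-increasing : ∀ h a l → h < a → T (strictIncᵇ (h ∷ run a l))
run-increasing h a zero    _   = _
run-increasing h a (suc l) h<a = ∧⁺ (<⇒<ᵇ h<a) (run-increasing a (suc a) l ≤-refl)

increasing-unique : ∀ xs → T (strictIncᵇ xs) → Unique xs
increasing-unique []       _   = []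
increasing-unique (x ∷ xs) inc =
  All.tabulate (λ y∈ x≡y → <-irrefl x≡y (head-below x xs inc y∈)) ∷ increasing-unique xs (strictInc-tail x xs inc)

hookTop : ℕ → ℕ → List ℕ
hookTop n k = 1 ∷ run (suc (suc k)) (n ∸ suc k)

hookTableau : ℕ → ℕ → List (List ℕ)
hookTableau n k = hookTop n k ∷ map [_] (run 2 k)

module HookTableau {n k} (k<n : k < n) where

  H : List (List ℕ)
  H = hookTableau n k

  top-run column-run : List ℕ
  top-run    = run (suc (suc k)) (n ∸ suc k)
  column-run = run 2 k

  ∈-top⁺ : ∀ {x} → suc (suc k) ≤ x → x ≤ n → x ∈ top-run
  ∈-top⁺ {x} k+2≤x x≤n = ∈-run⁺ _ _ k+2≤x (subst (x <_) (sym (cong suc (m+[n∸m]≡n k<n))) (s≤s x≤n))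

  ∈-top⁻ : ∀ {x} → x ∈ top-run → suc (suc k) ≤ x × x ≤ n
  ∈-top⁻ {x} x∈ with ∈-run⁻ _ _ x∈
  ... | k+2≤x , x<end = k+2≤x , s≤s⁻¹ (subst (x <_) (cong suc (m+[n∸m]≡n k<n)) x<end)

  concat-H : concat H ≡ hookTop n k ++ column-run
  concat-H = cong (hookTop n k ++_) (List.concat-map-[_] column-run)

  entries : ∀ {x} → x ∈ concat H → 1 ≤ x × x ≤ n
  entries {x} x∈ with ∈-++⁻ (hookTop n k) (subst (x ∈_) concat-H x∈)
  ... | inj₁ (here refl) = s≤s z≤n , ≤-trans (s≤s z≤n) k<n
  ... | inj₁ (there x∈′) = let k+2≤x , x≤n = ∈-top⁻ x∈′ in ≤-trans (s≤s z≤n) k+2≤x , x≤n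
  ... | inj₂ x∈′         = let 2≤x , x<k+2 = ∈-run⁻ 2 k x∈′ in ≤-trans (s≤s z≤n) 2≤x , s≤s⁻¹ (≤-trans x<k+2 (s≤s k<n))

  covers : ∀ {v} → 1 ≤ v → v ≤ n → v ∈ concat H
  covers {suc zero}    _ _   = here refl
  covers {suc (suc i)} _ v≤n with suc (suc i) ≤? suc k
  ... | yes v≤k+1 = subst (suc (suc i) ∈_) (sym concat-H) (∈-++⁺ʳ (hookTop n k) (∈-run⁺ 2 k (s≤s (s≤s z≤n)) (s≤s v≤k+1)))
  ... | no  v≰k+1 = there (∈-++⁺ˡ (∈-top⁺ (≰⇒> v≰k+1) v≤n))

  unique : Unique (concat H)
  unique = subst Unique (sym concat-H)
    (All.tabulate (λ x∈ 1≡x → <⇒≢ (two-or-more x∈) 1≡x)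
     ∷ Unique.++⁺ (increasing-unique top-run (strictInc-tail 1 top-run (run-increasing 1 (suc (suc k)) (n ∸ suc k) (s≤s (s≤s z≤n)))))
                  (increasing-unique column-run (strictInc-tail 1 column-run (run-increasing 1 2 k ≤-refl)))
                  (λ (x∈top , x∈col) → <⇒≱ (proj₂ (∈-run⁻ 2 k x∈col)) (proj₁ (∈-top⁻ x∈top))))
    where
    two-or-more : ∀ {x} → x ∈ top-run ++ column-run → 1 < x
    two-or-more x∈ with ∈-++⁻ top-run x∈
    ... | inj₁ x∈top = ≤-trans (s≤s (s≤s z≤n)) (proj₁ (∈-top⁻ x∈top))
    ... | inj₂ x∈col = proj₁ (∈-run⁻ 2 k x∈col)

  column-row : ∀ a m j → j < m → a + j ∈ Row (map [_] (run a m)) j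
  column-row a (suc m) zero    _         = here (+-identityʳ a)
  column-row a (suc m) (suc j) (s≤s j<m) =
    subst (_∈ Row (map [_] (run (suc a) m)) j) (sym (+-suc a j)) (column-row (suc a) m j j<m)

  -- H has the hook row function: as its entries are distinct, rowOf reads off their rows
  hook-rows : HookRows n k H
  hook-rows = record
    { first-column = λ { {zero} _ → exact 0 (here refl)
                       ; {suc i} i<k → exact (suc i) (column-row 2 k i i<k) }
    ; first-row    = λ k+2≤v v≤n → exact 0 (there (∈-top⁺ k+2≤v v≤n))
    }
    where
    exact : ∀ j {v} → v ∈ Row H j → rowOf v H ≡ j
    exact j v∈ = rowOf-exact H j (≤-reflexive (Mℕ.mult-unique unique (Row-∈-concat H j v∈))) v∈

  length-H : length (concat H) ≡ n
  length-H = begin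
    length (concat H)                  ≡⟨ cong length concat-H ⟩
    length (hookTop n k ++ column-run) ≡⟨ length-++ (hookTop n k) ⟩
    suc (length top-run) + length column-run ≡⟨ cong₂ (λ a b → suc a + b) (length-run _ (n ∸ suc k)) (length-run 2 k) ⟩
    suc (n ∸ suc k) + k                ≡⟨ cong (_+ k) (sym (+-∸-assoc 1 k<n)) ⟩
    n ∸ k + k                          ≡⟨ m∸n+n≡m (<⇒≤ k<n) ⟩
    n                                  ∎
    where open ≡-Reasoning

  shape : map length H ≡ hook n k
  shape = cong₂ _∷_ (trans (cong suc (length-run _ (n ∸ suc k))) (sym (+-∸-assoc 1 k<n))) (single-lengths 2 k)
    where
    single-lengths : ∀ a m → map length (map [_] (run a m)) ≡ replicate m 1
    single-lengths a zero    = refl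
    single-lengths a (suc m) = cong (1 ∷_) (single-lengths (suc a) m)

  -- columns of a hook tableau increase: only the first column has more than one cell
  columns : ∀ j → T (colsᵇ (hookTableau n j))
  columns zero    = _
  columns (suc j) = ∧⁺ (above-nothing (run (suc (suc (suc j))) (n ∸ suc (suc j)))) (singletons-above 2 (suc j))
    where
    above-nothing : ∀ R → T (aboveᵇ R [])
    above-nothing []      = _
    above-nothing (_ ∷ _) = _
    singletons-above : ∀ a m → T (colsᵇ (map [_] (run a m)))
    singletons-above a zero          = _
    singletons-above a (suc zero)    = _
    singletons-above a (suc (suc m)) = ∧⁺ (∧⁺ (<⇒<ᵇ (n<1+n a)) _) (singletons-above (suc a) (suc m))

  standardᵇ : T (IsStandardᵇ n H)
  standardᵇ = ∧⁺ (≡⇒≡ᵇ _ n length-H) (∧⁺ counts (∧⁺ rows (columns k)))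
    where
    counts : T (all (λ v → countᵇ v (concat H) ≡ᵇ 1) (oneTo n))
    counts = all⁻ _ (All.tabulate λ {v} v∈ → let 1≤v , v≤n = ∈-oneTo⁻ v∈ in
               ≡⇒≡ᵇ _ 1 (trans (countᵇ≡mult v (concat H)) (Mℕ.mult-unique unique (covers 1≤v v≤n))))
    rows : T (all strictIncᵇ H)
    rows = all⁻ strictIncᵇ {hookTop n k ∷ map [_] column-run}
             (run-increasing 1 (suc (suc k)) (n ∸ suc k) (s≤s (s≤s z≤n)) ∷ All.map⁺ (All.universal (λ _ → _) column-run))

  standard : Standard n H
  standard = standard-view n H entries (s≤s z≤n ∷ All.map⁺ (All.universal (λ _ → s≤s z≤n) column-run)) standardᵇ

  descents : DesT n H ≡ interval k
  descents = hook-descents k<n hook-rows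

partition-sum : ∀ {n} μ → T (IsPartitionᵇ n μ) → sum μ ≡ n
partition-sum {n} μ part = ≡ᵇ⇒≡ (sum μ) n (proj₁ (∧⁻ {sum μ ≡ᵇ n} part))

partition-positive : ∀ {n} μ → T (IsPartitionᵇ n μ) → All (0 <_) μ
partition-positive {n} μ part =
  All.map (λ {x} → <ᵇ⇒< 0 x) (all⁺ (0 <ᵇ_) μ (proj₁ (∧⁻ {all (0 <ᵇ_) μ} (proj₂ (∧⁻ {sum μ ≡ᵇ n} part)))))

hook-partition : ∀ {n k} → k < n → T (IsPartitionᵇ n (hook n k))
hook-partition {n} {k} k<n = ∧⁺ (≡⇒≡ᵇ _ n sum-hook) (∧⁺ (∧⁺ (<⇒<ᵇ (m<n⇒0<n∸m k<n)) (ones-positive k)) (decreasing k k<n))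
  where
  sum-hook : sum (hook n k) ≡ n
  sum-hook = trans (cong (n ∸ k +_) (ones-sum k)) (m∸n+n≡m (<⇒≤ k<n))
    where
    ones-sum : ∀ j → sum (replicate j 1) ≡ j
    ones-sum zero    = refl
    ones-sum (suc j) = cong suc (ones-sum j)
  ones-positive : ∀ j → T (all (0 <ᵇ_) (replicate j 1))
  ones-positive zero    = _
  ones-positive (suc j) = ones-positive j
  ones-decreasing : ∀ j → T (weaklyDecᵇ (1 ∷ replicate j 1))
  ones-decreasing zero    = _
  ones-decreasing (suc j) = ones-decreasing j
  decreasing : ∀ j → j < n → T (weaklyDecᵇ (hook n j))
  decreasing zero    _   = _
  decreasing (suc j) j<n = ∧⁺ (<⇒<ᵇ (m<n⇒0<n∸m j<n)) (ones-decreasing j)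

unique-filling : ∀ {n k μ w} → k < n → T (IsPartitionᵇ n μ) → w ∈ words n (oneTo n)
               → T (IsStandardᵇ n (splitRows μ w)) → DesT n (splitRows μ w) ≡ interval k
               → splitRows μ w ≡ hookTableau n k
unique-filling {n} {k} {μ} {w} k<n part w∈ std des =
  same-row-function S (HookTableau.standard k<n)
    (hook-rows-agree (descents-force-hook-rows k<n S des) (HookTableau.hook-rows k<n))
  where
  fits : length w ≡ sum μ
  fits = trans (proj₁ (words-∈⁻ n (oneTo n) w∈)) (sym (partition-sum μ part))
  range : ∀ {x} → x ∈ concat (splitRows μ w) → 1 ≤ x × x ≤ n
  range {x} x∈ = ∈-oneTo⁻ (All.lookup (proj₂ (words-∈⁻ n (oneTo n) w∈)) (subst (x ∈_) (splitRows-concat μ w fits) x∈))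
  nonempty : All (λ R → 0 < length R) (splitRows μ w)
  nonempty = All.map⁻ (subst (All (0 <_)) (sym (splitRows-lengths μ w fits)) (partition-positive μ part))
  S : Standard n (splitRows μ w)
  S = standard-view n (splitRows μ w) range nonempty std

countSYT-hook : ∀ {n k} → k < n → countSYT n (hook n k) (interval k) ≡ 1
countSYT-hook {n} {k} k<n =
  trans (Mw.count-images-unique (splitRows (hook n k)) (IsStandardᵇ n) {P = λ τ → DesT n τ ≡ interval k} (λ τ → DesT n τ ≟ₛ interval k)
           (words n (oneTo n)) (concat H) only (subst (T ∘ IsStandardᵇ n) (sym split-H) standardᵇ)
           (trans (cong (DesT n) split-H) descents))
        (mult-words n (oneTo n) (concat H) length-H
           (All.tabulate λ a∈ → let 1≤a , a≤n = entries a∈ in mult-oneTo 1≤a a≤n))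
  where
  open HookTableau k<n
  split-H : splitRows (hook n k) (concat H) ≡ H
  split-H = subst (λ μ → splitRows μ (concat H) ≡ H) shape (splitRows-concat-inverse H)
  only : ∀ w → w ∈ words n (oneTo n) → T (IsStandardᵇ n (splitRows (hook n k) w))
       → DesT n (splitRows (hook n k) w) ≡ interval k → w ≡ concat H
  only w w∈ std des =
    trans (sym (splitRows-concat (hook n k) w (trans (proj₁ (words-∈⁻ n (oneTo n) w∈)) (sym (partition-sum (hook n k) (hook-partition k<n))))))
          (cong concat (unique-filling {μ = hook n k} k<n (hook-partition k<n) w∈ std des))

countSYT-other : ∀ {n k μ} → k < n → μ ∈ partitions n → μ ≢ hook n k → countSYT n μ (interval k) ≡ 0
countSYT-other {n} {k} {μ} k<n μ∈ μ≢hook =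
  Mw.count-images-none (splitRows μ) (IsStandardᵇ n) {P = λ τ → DesT n τ ≡ interval k} (λ τ → DesT n τ ≟ₛ interval k) (words n (oneTo n)) λ w w∈ std des →
    μ≢hook (begin
      μ                              ≡⟨ sym (splitRows-lengths μ w (trans (proj₁ (words-∈⁻ n (oneTo n) w∈)) (sym (partition-sum μ part)))) ⟩
      map length (splitRows μ w)     ≡⟨ cong (map length) (unique-filling {μ = μ} k<n part w∈ std des) ⟩
      map length (hookTableau n k)   ≡⟨ HookTableau.shape k<n ⟩
      hook n k                       ∎)
  where
  open ≡-Reasoning
  part : T (IsPartitionᵇ n μ)
  part = proj₂ (∈-filter⁻ (T? ∘ IsPartitionᵇ n) {xs = concatMap (λ ℓ → words ℓ (oneTo n)) (upTo (suc n))} μ∈)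

mult-hook-partitions : ∀ {n k} → k < n → Mw.mult (hook n k) (partitions n) ≡ 1
mult-hook-partitions {n} {k} k<n = begin
  Mw.mult (hook n k) (partitions n)
    ≡⟨ Mw.mult-filterᵇ (IsPartitionᵇ n) candidates (hook-partition k<n) ⟩
  Mw.mult (hook n k) candidates
    ≡⟨ Mw.mult-concatMap (hook n k) (λ ℓ → words ℓ (oneTo n)) (upTo (suc n)) ⟩
  sum (map (λ ℓ → Mw.mult (hook n k) (words ℓ (oneTo n))) (upTo (suc n)))
    ≡⟨ Mℕ.sum-concentrated _ (suc k) (upTo (suc n))
         (λ ℓ _ ℓ≢ → mult-words-length ℓ (oneTo n) (hook n k) (λ len≡ℓ → ℓ≢ (trans (sym len≡ℓ) length-hook))) ⟩
  Mw.mult (hook n k) (words (suc k) (oneTo n)) * Mℕ.mult (suc k) (upTo (suc n))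
    ≡⟨ cong₂ _*_ (mult-words (suc k) (oneTo n) (hook n k) length-hook parts-once)
                 (Mℕ.mult-unique (Unique.upTo⁺ (suc n)) (∈-upTo⁺ (s≤s k<n))) ⟩
  1 ∎
  where
  open ≡-Reasoning
  candidates = concatMap (λ ℓ → words ℓ (oneTo n)) (upTo (suc n))
  length-hook : length (hook n k) ≡ suc k
  length-hook = cong suc (length-replicate k)
  parts-once : All (λ a → Mℕ.mult a (oneTo n) ≡ 1) (hook n k)
  parts-once = mult-oneTo (m<n⇒0<n∸m k<n) (m∸n≤m n k)
             ∷ All.replicate⁺ k (mult-oneTo ≤-refl (≤-trans (s≤s z≤n) k<n))

lemma3p7 : (n N : ℕ) (A : Fin N → Permutation′ n)
  → (∀ i j → (∀ x → A i ⟨$⟩ʳ x ≡ A j ⟨$⟩ʳ x) → i ≡ j)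
  → (∃ λ (ψ : Permutation′ N) → ∀ i → cDes (A (ψ ⟨$⟩ʳ i)) ≡ shift (cDes (A i)))
  → (m : List ℕ → ℕ)
  → (∀ J → countDes A J ≡ sum (map (λ μ → m μ * countSYT n μ J) (partitions n)))
  → ∀ k → k < n → m (hook n k) ≡ countDes A (interval k)
lemma3p7 n N A _ _ m expansion k k<n = sym (begin
  countDes A (interval k)
    ≡⟨ expansion (interval k) ⟩
  sum (map (λ μ → m μ * countSYT n μ (interval k)) (partitions n))
    ≡⟨ Mw.sum-concentrated _ (hook n k) (partitions n)
         (λ μ μ∈ μ≢hook → trans (cong (m μ *_) (countSYT-other k<n μ∈ μ≢hook)) (*-zeroʳ (m μ))) ⟩
  m (hook n k) * countSYT n (hook n k) (interval k) * Mw.mult (hook n k) (partitions n)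
    ≡⟨ cong₂ (λ a b → m (hook n k) * a * b) (countSYT-hook k<n) (mult-hook-partitions k<n) ⟩
  m (hook n k) * 1 * 1
    ≡⟨ trans (*-identityʳ _) (*-identityʳ _) ⟩
  m (hook n k) ∎)
  where open ≡-Reasoning
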